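{- Work in the type theory with identity types and the $\mathsf{app}$-formulation of dependent products, extended by the rules $\Pi$-prop-$\eta$, $\Pi$-prop-$\eta$-comp, $\Pi$-prop-$\xi$ and $\Pi$-prop-$\xi$-comp. Then the function extensionality rules are definable: for $m,n:\Pi(A,B)$ and $k:\Pi x:A.\,\mathsf{Id}_{B(x)}(m\cdot x,n\cdot x)$ one can define $\mathsf{ext}(m,n,k):\mathsf{Id}_{\Pi(A,B)}(m,n)$ such that $\mathsf{ext}(\lambda h,\lambda h,\lambda(rh))=r(\lambda h)$ for every $h:(x:A)\,B(x)$.
   Context: Intensional Martin-Löf type theory presented in the Logical Framework (rules may have higher-order premises such as $f:(x:A)\,B(x)$, a meta-level function; we write $fx$ for $f(x)$, $\lambda f$ for $\lambda(f)$, and $rf$ for $[x:A]\,r(fx)$). A rule is definable if terms realising it, with its stated definitional equalities, can be constructed from the given rules. Identity types: $\mathsf{Id}_A(a,b)$, $r(a):\mathsf{Id}_A(a,a)$, eliminator $J$ with $J(d,a,a,r(a))=d(a)$. $\mathsf{app}$-formulation of $\Pi$: formation $\Pi(A,B)$; abstraction $\lambda(f):\Pi(A,B)$; application $m\cdot a:B(a)$; $\beta$: $\lambda(f)\cdot a=f(a)$. Write $\lambda x.\,t(x)$ for $\lambda([x:A]\,t(x))$, $\Pi x:A.\,B(x)$ for $\Pi(A,[x:A]\,B(x))$. $\Pi$-prop-$\eta$: for $m:\Pi(A,B)$, $\eta(m):\mathsf{Id}_{\Pi(A,B)}(m,\lambda x.\,m\cdot x)$; $\Pi$-prop-$\eta$-comp: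 $\eta(\lambda f)=r(\lambda f)$. $\Pi$-prop-$\xi$: for $f,g:(x:A)\,B(x)$ and $p:(x:A)\,\mathsf{Id}_{B(x)}(fx,gx)$, $\xi(f,g,p):\mathsf{Id}_{\Pi(A,B)}(\lambda f,\lambda g)$; $\Pi$-prop-$\xi$-comp: $\xi(f,f,rf)=r(\lambda f)$. -}

module Defs where

open import Level using (Level; _⊔_) renaming (suc to lsuc)
open import Relation.Binary.PropositionalEquality using (_≡_; subst; sym)

-- Object types are codes in Ty, their terms El A; LF meta-level functions
-- (x:A) B(x) are Agda functions; object definitional equality is Agda ≡.
record TT (ℓ ℓ' : Level) : Set (lsuc (ℓ ⊔ ℓ')) where
  field
    Ty : Set ℓ
    El : Ty → Set ℓ'
    Id   : (A : Ty) → El A → El A → Ty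
    r    : {A : Ty} (a : El A) → El (Id A a a)
    J    : {A : Ty} (C : (x y : El A) → El (Id A x y) → Ty)
           (d : (x : El A) → El (C x x (r x)))
           (a b : El A) (p : El (Id A a b)) → El (C a b p)
    J-comp : {A : Ty} (C : (x y : El A) → El (Id A x y) → Ty)
             (d : (x : El A) → El (C x x (r x))) (a : El A) →
             J C d a a (r a) ≡ d a
    Π    : (A : Ty) → (El A → Ty) → Ty
    lam  : {A : Ty} {B : El A → Ty} → ((x : El A) → El (B x)) → El (Π A B)
    app  : {A : Ty} {B : El A → Ty} → El (Π A B) → (x : El A) → El (B x)
    -- β: λ(f)·a = f(a), as a (congruent) definitional equality of abstractions
    β    : {A : Ty} {B : El A → Ty} (f : (x : El A) → El (B x)) →
           app {A} {B} (lam f) ≡ f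
    η    : {A : Ty} {B : El A → Ty} (m : El (Π A B)) →
           El (Id (Π A B) m (lam (app m)))
    η-comp : {A : Ty} {B : El A → Ty} (f : (x : El A) → El (B x)) →
             subst (λ g → El (Id (Π A B) (lam f) (lam g))) (β f) (η (lam f))
               ≡ r (lam f)
    ξ    : {A : Ty} {B : El A → Ty} (f g : (x : El A) → El (B x)) →
           ((x : El A) → El (Id (B x) (f x) (g x))) →
           El (Id (Π A B) (lam f) (lam g))
    ξ-comp : {A : Ty} {B : El A → Ty} (f : (x : El A) → El (B x)) →
             ξ f f (λ x → r (f x)) ≡ r (lam f)

record ExtRules {ℓ ℓ' : Level} (T : TT ℓ ℓ') : Set (ℓ ⊔ ℓ') where
  open TT T
  field
    ext : {A : Ty} {B : El A → Ty} (m n : El (Π A B)) →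
          El (Π A (λ x → Id (B x) (app m x) (app n x))) →
          El (Id (Π A B) m n)
    -- ext(λh, λh, λ(rh)) = r(λh); λ(rh) is retyped along β
    ext-comp : {A : Ty} {B : El A → Ty} (h : (x : El A) → El (B x)) →
               ext (lam h) (lam h)
                   (subst (λ g → El (Π A (λ x → Id (B x) (g x) (g x))))
                          (sym (β h)) (lam (λ x → r (h x))))
                 ≡ r (lam h)

module Submission where

open import Defs
open import Level using (Level)
open import Relation.Binary.PropositionalEquality
  using (_≡_; refl; trans; cong; cong₂; sym; subst; module ≡-Reasoning)

-- ext(m, n, k) := η(m) ∙ ξ(m·_, n·_, k·_) ∙ η(n)⁻¹.  For m = n = λh the
-- η-comp and ξ-comp rules reduce every factor to a reflexivity, and
-- composition and inversion compute on reflexivity by the J computation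
-- rule.  The only subtlety is that (λh)·_ is h only up to β,
-- which is handled by abstracting over the β-equation and matching on it.

module Extensionality {ℓ ℓ' : Level} (T : TT ℓ ℓ') where
  open TT T

  -- Composition is by J on the second path, into a Π-type so that
  -- the first path can be supplied by application.
  infixr 5 _∙_
  infix 6 _⁻¹

  _∙_ : {A : Ty} {a b c : El A} → El (Id A a b) → El (Id A b c) → El (Id A a c)
  _∙_ {A} {a} {b} {c} p q =
    app (J (λ y z _ → Π (Id A a y) (λ _ → Id A a z)) (λ y → lam (λ p → p)) b c q) p

  ∙-identityʳ : {A : Ty} {a b : El A} (p : El (Id A a b)) → p ∙ r b ≡ p
  ∙-identityʳ {A} {a} {b} p = begin
    app (J C (λ y → lam (λ p → p)) b b (r b)) p  ≡⟨ cong (λ F → app F p) (J-comp C (λ y → lam (λ p → p)) b) ⟩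
    app (lam (λ p → p)) p                         ≡⟨ cong (λ f → f p) (β (λ p → p)) ⟩
    p                                             ∎
    where
    open ≡-Reasoning
    C : (y z : El A) → El (Id A y z) → Ty
    C y z _ = Π (Id A a y) (λ _ → Id A a z)

  _⁻¹ : {A : Ty} {a b : El A} → El (Id A a b) → El (Id A b a)
  _⁻¹ {A} {a} {b} p = J (λ x y _ → Id A y x) r a b p

  r⁻¹ : {A : Ty} (a : El A) → r a ⁻¹ ≡ r a
  r⁻¹ {A} = J-comp (λ x y _ → Id A y x) r

  ext : {A : Ty} {B : El A → Ty} (m n : El (Π A B)) →
        El (Π A (λ x → Id (B x) (app m x) (app n x))) → El (Id (Π A B) m n)
  ext m n k = η m ∙ ξ (app m) (app n) (app k) ∙ η n ⁻¹

  r∙ξ-r∙r⁻¹≡r : {A : Ty} {B : El A → Ty} (h : (x : El A) → El (B x)) →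
           r (lam h) ∙ ξ h h (λ x → r (h x)) ∙ r (lam h) ⁻¹ ≡ r (lam h)
  r∙ξ-r∙r⁻¹≡r h = begin
    r (lam h) ∙ ξ h h (λ x → r (h x)) ∙ r (lam h) ⁻¹ ≡⟨ cong₂ (λ u v → r (lam h) ∙ u ∙ v) (ξ-comp h) (r⁻¹ (lam h)) ⟩
    r (lam h) ∙ r (lam h) ∙ r (lam h)                  ≡⟨ cong (r (lam h) ∙_) (∙-identityʳ (r (lam h))) ⟩
    r (lam h) ∙ r (lam h)                              ≡⟨ ∙-identityʳ (r (lam h)) ⟩
    r (lam h)                                          ∎
    where open ≡-Reasoning

  -- Stated for an arbitrary g with g ≡ h and an arbitrary η-witness so that
  -- the β-equation (instantiated at app (lam h) ≡ h) can be matched on.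
  ext-comp-along : {A : Ty} {B : El A → Ty} (h g : (x : El A) → El (B x)) (e : g ≡ h)
    (p : El (Id (Π A B) (lam h) (lam g))) →
    subst (λ g → El (Id (Π A B) (lam h) (lam g))) e p ≡ r (lam h) →
    p ∙ ξ g g (app (subst (λ g → El (Π A (λ x → Id (B x) (g x) (g x))))
                             (sym e) (lam (λ x → r (h x))))) ∙ p ⁻¹
      ≡ r (lam h)
  ext-comp-along h .h refl .(r (lam h)) refl =
    trans (cong (λ k → r (lam h) ∙ ξ h h k ∙ r (lam h) ⁻¹) (β (λ x → r (h x)))) (r∙ξ-r∙r⁻¹≡r h)

  extRules : ExtRules T
  extRules = record
    { ext      = ext
    ; ext-comp = λ h → ext-comp-along h (app (lam h)) (β h) (η (lam h)) (η-comp h)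
    }

proposition5p4 : {ℓ ℓ' : Level} (T : TT ℓ ℓ') → ExtRules T
proposition5p4 = Extensionality.extRules
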